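{- Let $k>0$, let $G=(V,E)$ be a graph with no isolated vertices, let $\chi:V\to[k]$ be a proper coloring of $G$, let $\alpha\ge0$, and let $\mathrm{pos}:V\to[0,1]$ be the fractional assignment defined below. Then \[ \left(\tfrac12-\alpha\right)\cdot\mathrm{maxval}(G)\le\mathrm{val}_G(\mathrm{pos})\le\mathrm{maxval}(G). \]
   Context: A graph is a directed multigraph $G=(V,E)$: $V$ finite, $E$ a finite multiset of ordered pairs $(u,v)$, $u\ne v$. A proper coloring $\chi:V\to[k]$ has $\chi(u)\ne\chi(v)$ on every edge. For $x:V\to[0,1]$, $\mathrm{val}_G(x)=\frac1{|E|}\sum_{(u,v)\in E}x(u)(1-x(v))$ (with multiplicity), and $\mathrm{maxval}(G)=\max_{x:V\to\{0,1\}}\mathrm{val}_G(x)$. For $v\in V$ define the multisets $E_{in,lo}(v)=\{(u,v)\in E:\chi(u)<\chi(v)\}$, $E_{out,lo}(v)=\{(v,u)\in E:\chi(u)<\chi(v)\}$, $E_{in,hi}(v)=\{(u,v)\in E:\chi(u)>\chi(v)\}$, $E_{out,hi}(v)=\{(v,u)\in E:\chi(u)>\chi(v)\}$, and $y_{in}(v)=\max(|E_{in,hi}(v)|,\alpha|E_{in,lo}(v)|)$, $y_{out}(v)=\max(|E_{out,hi}(v)|,\alpha|E_{out,lo}(v)|)$. The values $\mathrm{pos}(v)$ are defined recursively in increasing order of $\chi(v)$: $z_{in}(v)=\sum_{(u,v)\in E_{in,lo}(v)}\mathrm{pos}(u)$, $z_{out}(v)=\sum_{(v,u)\in E_{out,lo}(v)}(1-\mathrm{pos}(u))$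 (sums with multiplicity), and with $x=z_{in}(v)-z_{out}(v)$: $\mathrm{pos}(v)=1$ if $x\le-y_{in}(v)$; $\mathrm{pos}(v)=\frac{y_{out}(v)-x}{y_{in}(v)+y_{out}(v)}$ if $-y_{in}(v)<x\le y_{out}(v)$; $\mathrm{pos}(v)=0$ if $x>y_{out}(v)$. (Since $v$ is not isolated, $y_{in}(v)+y_{out}(v)>0$.)
   Formalization: The parameter α ranges over the nonnegative rationals, so the fractional assignment pos takes rational values. -}

module Defs where

open import Data.Nat as ℕ using (ℕ; zero; suc)
open import Data.Integer using (+_)
open import Data.Fin using (Fin; toℕ)
open import Data.Bool using (Bool; true; false; if_then_else_)
open import Data.List using (List; []; _∷_; length; filter; map; foldr; _++_)
open import Data.List.Relation.Unary.All using (All)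
open import Data.List.Relation.Unary.Any using (Any)
open import Data.Product using (_×_; _,_; proj₁; proj₂)
open import Data.Sum using (_⊎_)
open import Data.Rational using (ℚ; 0ℚ; 1ℚ; _+_; _-_; _*_; -_; _÷_; _⊔_; _≤_; _<_; _/_)
open import Data.Rational.Properties using (_≤?_; _≟_)
import Data.Rational.Base as ℚB
open import Relation.Nullary using (¬_; yes; no)
open import Relation.Binary.PropositionalEquality using (_≡_; _≢_)

record Graph (n : ℕ) : Set where
  constructor mkGraph
  field
    edges   : List (Fin n × Fin n)
    noLoops : All (λ e → proj₁ e ≢ proj₂ e) edges
open Graph public

Incident : ∀ {n} → Fin n → Fin n × Fin n → Set
Incident v (a , b) = (a ≡ v) ⊎ (b ≡ v)

NoIsolated : ∀ {n} → Graph n → Set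
NoIsolated {n} G = (v : Fin n) → Any (Incident v) (edges G)

Proper : ∀ {n k} → Graph n → (Fin n → Fin k) → Set
Proper G χ = All (λ e → χ (proj₁ e) ≢ χ (proj₂ e)) (edges G)

sumℚ : List ℚ → ℚ
sumℚ = foldr _+_ 0ℚ

ℕtoℚ : ℕ → ℚ
ℕtoℚ m = (+ m) / 1

weight : ∀ {n} → List (Fin n × Fin n) → (Fin n → ℚ) → ℚ
weight E x = sumℚ (map (λ e → x (proj₁ e) * (1ℚ - x (proj₂ e))) E)

-- val_G(x) = weight / |E|.  (Convention: 0 if E is empty; never used
-- when there is at least one vertex and no isolated vertices.)
val : ∀ {n} → Graph n → (Fin n → ℚ) → ℚ
val G x with edges G
... | []     = 0ℚ
... | e ∷ es = weight (e ∷ es) x * ((+ 1) / suc (length es))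

boolToℚ : Bool → ℚ
boolToℚ true  = 1ℚ
boolToℚ false = 0ℚ

allAssignments : (n : ℕ) → List (Fin n → Bool)
allAssignments zero    = (λ ()) ∷ []
allAssignments (suc n) =
  map (λ f → λ { Fin.zero → false ; (Fin.suc i) → f i }) (allAssignments n)
  ++ map (λ f → λ { Fin.zero → true ; (Fin.suc i) → f i }) (allAssignments n)

-- maxval(G) = max over x : V → {0,1} of val_G(x)  (values are ≥ 0 and the
-- list of assignments is nonempty, so starting the fold at 0 is harmless)
maxval : ∀ {n} → Graph n → ℚ
maxval {n} G = foldr _⊔_ 0ℚ (map (λ b → val G (λ v → boolToℚ (b v))) (allAssignments n))

-- pos(v) as a function of x = z_in - z_out, y_in, y_out
posFormula : (x yin yout : ℚ) → ℚ
posFormula x yin yout with x ≤? (- yin) | x ≤? yout | yin + yout ≟ 0ℚ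
... | yes _ | _     | _     = 1ℚ
... | no _  | no _  | _     = 0ℚ
... | no _  | yes _ | yes _ = 0ℚ   -- unreachable: -yin < x ≤ yout forces yin + yout > 0
... | no _  | yes _ | no ≢0 = (yout - x) ÷ (yin + yout)
  where instance _ = ℚB.≢-nonZero ≢0

module _ {n k : ℕ} (G : Graph n) (χ : Fin n → Fin k) (α : ℚ) where

  private
    lt : Fin n → Fin n → Bool
    lt a b = toℕ (χ a) ℕ.<ᵇ toℕ (χ b)

    count : List (Fin n × Fin n) → ℚ
    count l = ℕtoℚ (length l)

  Ein-lo Eout-lo Ein-hi Eout-hi : Fin n → List (Fin n × Fin n)
  Ein-lo  v = filter (λ e → (proj₂ e Data.Fin.≟ v) Relation.Nullary.×-dec
                           Relation.Nullary.Decidable.T? (lt (proj₁ e) v)) (edges G)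
    where import Relation.Nullary.Decidable
  Eout-lo v = filter (λ e → (proj₁ e Data.Fin.≟ v) Relation.Nullary.×-dec
                           Relation.Nullary.Decidable.T? (lt (proj₂ e) v)) (edges G)
    where import Relation.Nullary.Decidable
  Ein-hi  v = filter (λ e → (proj₂ e Data.Fin.≟ v) Relation.Nullary.×-dec
                           Relation.Nullary.Decidable.T? (lt v (proj₁ e))) (edges G)
    where import Relation.Nullary.Decidable
  Eout-hi v = filter (λ e → (proj₁ e Data.Fin.≟ v) Relation.Nullary.×-dec
                           Relation.Nullary.Decidable.T? (lt v (proj₂ e))) (edges G)
    where import Relation.Nullary.Decidable

  y-in y-out : Fin n → ℚ
  y-in  v = count (Ein-hi v)  ⊔ (α * count (Ein-lo v))
  y-out v = count (Eout-hi v) ⊔ (α * count (Eout-lo v))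

  z-in z-out : Fin n → (Fin n → ℚ) → ℚ
  z-in  v p = sumℚ (map (λ e → p (proj₁ e)) (Ein-lo v))
  z-out v p = sumℚ (map (λ e → 1ℚ - p (proj₂ e)) (Eout-lo v))

  step : Fin n → (Fin n → ℚ) → ℚ
  step v p = posFormula (z-in v p - z-out v p) (y-in v) (y-out v)

  -- Recursion in increasing order of color: posUpTo c is correct on all
  -- vertices of color < c (posUpTo 0 is a dummy), and step v only reads
  -- values of vertices of color < χ(v).
  posUpTo : ℕ → Fin n → ℚ
  posUpTo zero    v = 0ℚ
  posUpTo (suc c) v = step v (posUpTo c)

  pos : Fin n → ℚ
  pos v = posUpTo (suc (toℕ (χ v))) v

{-# OPTIONS --safe #-}
-- The weight W x = Σ_{(u,w) ∈ E} x u (1 - x w) is affine in every coordinate, so on [0,1]^V it is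
-- maximised at a Boolean point; hence val pos ≤ maxval.
-- For the lower bound fix a Boolean b and move the vertices from pos to b in order of colour:
-- W b - W pos telescopes into Σ_v (b v - pos v) (O v - I v - x v), where x v = z_in v - z_out v
-- reads the lower-coloured neighbours at pos and I v, O v read the higher-coloured ones at b.
-- The rule defining pos v balances the two roundings of v, which bounds the term of v by
-- ½ (pos v (|E_out,hi v| - x v) + (1 - pos v) (x v + |E_in,hi v|)) + ½ α (|E_in,lo v| + |E_out,lo v|).
-- Summed over v, every edge being counted once at each endpoint, these bounds give W pos + 2α W(½).
-- Hence val b ≤ 2 val pos + 2α val(½) ≤ 2 val pos + 2α maxval for every b.
module Submission where

open import Defs
open import Data.Nat using (ℕ; NonZero)
open import Data.Fin using (Fin)
open import Data.Rational using (ℚ; 0ℚ; ½; _-_; _*_; _≤_)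
open import Data.Product using (_×_)

open import Data.Rational.Properties hiding (_≟_; _≤?_)
import Data.Rational.Properties as ℚ
open import Algebra.Properties.CommutativeMonoid.Sum +-0-commutativeMonoid
  using (sum; sum-syntax; ∑-distrib-+; sum-cong-≗; sum-replicate-zero)
open import Data.Bool using (Bool; true; false; if_then_else_; T; not; _∧_)
open import Data.Empty using (⊥-elim)
open import Data.Fin using (zero; suc; toℕ; _≟_)
import Data.Fin.Properties as Fin
import Data.Integer as ℤ
import Data.Integer.Properties as ℤ
open import Data.List using (List; []; _∷_; map; filter; length; foldr)
open import Data.List.Relation.Unary.All as All using (All; []; _∷_)
import Data.List.Relation.Unary.All.Properties as All
open import Data.List.Relation.Unary.Any as Any using (Any; here; there)
import Data.List.Relation.Unary.Any.Properties as Any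
import Data.Nat as ℕ
import Data.Nat.Properties as ℕ
import Data.Nat.Coprimality as Coprime
open import Data.Product using (_,_; proj₁; proj₂)
open import Data.Rational
  using (1ℚ; _+_; -_; _/_; _<_; _÷_; _⊔_; 1/_; Positive; ≢-nonZero; nonNegative; positive)
open import Data.Rational.Solver using (module +-*-Solver)
open import Data.Sum using (_⊎_; inj₁; inj₂)
open import Data.Unit using (tt)
open import Data.Vec.Functional using (tail; updateAt) renaming (_∷_ to _∷ᶠ_)
open import Data.Vec.Functional.Properties using (updateAt-updates; updateAt-minimal)
open import Function using (_∘_; const)
open import Relation.Binary.PropositionalEquality
  using (_≡_; _≢_; _≗_; refl; sym; trans; cong; cong₂; subst; subst₂; module ≡-Reasoning)
open import Relation.Nullary using (yes; no; does; Dec; Reflects; ofʸ; ofⁿ)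
open import Relation.Nullary.Decidable using (T?; _×-dec_)

open +-*-Solver
open ≡-Reasoning

p≤q⇒0≤q-p : ∀ {p q} → p ≤ q → 0ℚ ≤ q - p
p≤q⇒0≤q-p {p} {q} p≤q = subst (_≤ q - p) (+-inverseʳ p) (+-monoˡ-≤ (- p) p≤q)

0≤q-p⇒p≤q : ∀ {p q} → 0ℚ ≤ q - p → p ≤ q
0≤q-p⇒p≤q {p} {q} 0≤q-p =
  subst₂ _≤_ (+-identityʳ p) (solve 2 (λ p q → p :+ (q :- p) := q) refl p q) (+-monoʳ-≤ p 0≤q-p)

≤-byDifference : ∀ {p q d} → 0ℚ ≤ d → d ≡ q - p → p ≤ q
≤-byDifference 0≤d refl = 0≤q-p⇒p≤q 0≤d

0≤+ : ∀ {p q} → 0ℚ ≤ p → 0ℚ ≤ q → 0ℚ ≤ p + q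
0≤+ = +-mono-≤

0≤* : ∀ {p q} → 0ℚ ≤ p → 0ℚ ≤ q → 0ℚ ≤ p * q
0≤* {p} {q} 0≤p 0≤q =
  nonNegative⁻¹ _ {{nonNeg*nonNeg⇒nonNeg p {{nonNegative 0≤p}} q {{nonNegative 0≤q}}}}

0≤p*p : ∀ p → 0ℚ ≤ p * p
0≤p*p p with ≤-total 0ℚ p
... | inj₁ 0≤p = 0≤* 0≤p 0≤p
... | inj₂ p≤0 = subst (0ℚ ≤_) (solve 1 (λ p → (:- p) :* (:- p) := p :* p) refl p) (0≤* 0≤-p 0≤-p)
  where
  0≤-p : 0ℚ ≤ - p
  0≤-p = neg-antimono-≤ p≤0

0≤+*zero : ∀ {q d} c → 0ℚ ≤ q → d ≡ 0ℚ → 0ℚ ≤ q + c * d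
0≤+*zero {q} c 0≤q refl = subst (0ℚ ≤_) (solve 2 (λ q c → q := q :+ c :* con 0ℚ) refl q c) 0≤q

p⊔q≤p+q : ∀ {p q} → 0ℚ ≤ p → 0ℚ ≤ q → p ⊔ q ≤ p + q
p⊔q≤p+q {p} {q} 0≤p 0≤q = ⊔-lub
  (≤-byDifference 0≤q (solve 2 (λ p q → q := (p :+ q) :- p) refl p q))
  (≤-byDifference 0≤p (solve 2 (λ p q → p := (p :+ q) :- q) refl p q))

convex-≤ : ∀ {t a b c} → 0ℚ ≤ t → t ≤ 1ℚ → a ≤ c → b ≤ c → (1ℚ - t) * a + t * b ≤ c
convex-≤ {t} {a} {b} {c} 0≤t t≤1 a≤c b≤c = ≤-byDifference
  (0≤+ (0≤* (p≤q⇒0≤q-p t≤1) (p≤q⇒0≤q-p a≤c)) (0≤* 0≤t (p≤q⇒0≤q-p b≤c)))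
  (solve 4 (λ t a b c → (con 1ℚ :- t) :* (c :- a) :+ t :* (c :- b)
                       := c :- ((con 1ℚ :- t) :* a :+ t :* b)) refl t a b c)

_∈[0,1] : ℚ → Set
q ∈[0,1] = 0ℚ ≤ q × q ≤ 1ℚ

boolToℚ∈[0,1] : ∀ b → boolToℚ b ∈[0,1]
boolToℚ∈[0,1] false = ≤-refl , ≤ᵇ⇒≤ tt
boolToℚ∈[0,1] true  = ≤ᵇ⇒≤ tt , ≤-refl

0≤½ : 0ℚ ≤ ½
0≤½ = ≤ᵇ⇒≤ tt

½∈[0,1] : ½ ∈[0,1]
½∈[0,1] = 0≤½ , ≤ᵇ⇒≤ tt

complement∈[0,1] : ∀ {q} → q ∈[0,1] → (1ℚ - q) ∈[0,1]
complement∈[0,1] {q} (0≤q , q≤1) =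
  p≤q⇒0≤q-p q≤1 , ≤-byDifference 0≤q (solve 1 (λ q → q := con 1ℚ :- (con 1ℚ :- q)) refl q)

0≤ℕtoℚ : ∀ m → 0ℚ ≤ ℕtoℚ m
0≤ℕtoℚ m = nonNegative⁻¹ _ {{normalize-nonNeg m 1}}

ℕtoℚ-suc : ∀ m → ℕtoℚ (ℕ.suc m) ≡ 1ℚ + ℕtoℚ m
ℕtoℚ-suc m = sym (begin
  1ℚ + ℕtoℚ m                            ≡⟨ cong (1ℚ +_) (normalize-coprime (Coprime.sym (Coprime.1-coprimeTo m))) ⟩
  (ℤ.+ 1 ℤ.+ ℤ.+ m ℤ.* ℤ.+ 1) / 1      ≡⟨ cong (λ i → (ℤ.+ 1 ℤ.+ i) / 1) (ℤ.*-identityʳ (ℤ.+ m)) ⟩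
  ℕtoℚ (ℕ.suc m)                         ∎)

module _ {A : Set} where

  sum-cong : ∀ {f g : A → ℚ} {l} → All (λ e → f e ≡ g e) l → sumℚ (map f l) ≡ sumℚ (map g l)
  sum-cong []         = refl
  sum-cong (eq ∷ eqs) = cong₂ _+_ eq (sum-cong eqs)

  sum-mono-≤ : ∀ {f g : A → ℚ} {l} → All (λ e → f e ≤ g e) l → sumℚ (map f l) ≤ sumℚ (map g l)
  sum-mono-≤ []         = ≤-refl
  sum-mono-≤ (le ∷ les) = +-mono-≤ le (sum-mono-≤ les)

  sum-+ : ∀ (f g : A → ℚ) l → sumℚ (map (λ e → f e + g e) l) ≡ sumℚ (map f l) + sumℚ (map g l)
  sum-+ f g []      = refl
  sum-+ f g (e ∷ l) = trans (cong (f e + g e +_) (sum-+ f g l))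
    (solve 4 (λ a b c d → (a :+ b) :+ (c :+ d) := (a :+ c) :+ (b :+ d)) refl
       (f e) (g e) (sumℚ (map f l)) (sumℚ (map g l)))

  sum-- : ∀ (f g : A → ℚ) l → sumℚ (map (λ e → f e - g e) l) ≡ sumℚ (map f l) - sumℚ (map g l)
  sum-- f g []      = refl
  sum-- f g (e ∷ l) = trans (cong (f e - g e +_) (sum-- f g l))
    (solve 4 (λ a b c d → (a :- b) :+ (c :- d) := (a :+ c) :- (b :+ d)) refl
       (f e) (g e) (sumℚ (map f l)) (sumℚ (map g l)))

  sum-+₄ : ∀ (f g h k : A → ℚ) l → sumℚ (map (λ e → f e + g e + h e + k e) l)
           ≡ sumℚ (map f l) + sumℚ (map g l) + sumℚ (map h l) + sumℚ (map k l)
  sum-+₄ f g h k l =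
    trans (sum-+ (λ e → f e + g e + h e) k l)
          (cong (_+ sumℚ (map k l)) (trans (sum-+ (λ e → f e + g e) h l)
                                          (cong (_+ sumℚ (map h l)) (sum-+ f g l))))

  sum-*ˡ : ∀ c (f : A → ℚ) l → sumℚ (map (λ e → c * f e) l) ≡ c * sumℚ (map f l)
  sum-*ˡ c f []      = sym (*-zeroʳ c)
  sum-*ˡ c f (e ∷ l) = trans (cong (c * f e +_) (sum-*ˡ c f l)) (sym (*-distribˡ-+ c (f e) _))

  sum-const : ∀ c (l : List A) → sumℚ (map (λ _ → c) l) ≡ c * ℕtoℚ (length l)
  sum-const c []      = sym (*-zeroʳ c)
  sum-const c (e ∷ l) = begin
    c + sumℚ (map (λ _ → c) l)      ≡⟨ cong (c +_) (sum-const c l) ⟩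
    c + c * ℕtoℚ (length l)         ≡⟨ solve 2 (λ c m → c :+ c :* m := c :* (con 1ℚ :+ m)) refl c _ ⟩
    c * (1ℚ + ℕtoℚ (length l))      ≡⟨ cong (c *_) (ℕtoℚ-suc (length l)) ⟨
    c * ℕtoℚ (length (e ∷ l))       ∎

  sum-affine : ∀ c (f : A → ℚ) d l →
    sumℚ (map (λ e → c * f e + d) l) ≡ c * sumℚ (map f l) + d * ℕtoℚ (length l)
  sum-affine c f d l = trans (sum-+ (λ e → c * f e) (λ _ → d) l) (cong₂ _+_ (sum-*ˡ c f l) (sum-const d l))

  0≤sum : ∀ {f : A → ℚ} {l} → All (λ e → 0ℚ ≤ f e) l → 0ℚ ≤ sumℚ (map f l)
  0≤sum []           = ≤-refl
  0≤sum (0≤fe ∷ 0≤f) = 0≤+ 0≤fe (0≤sum 0≤f)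

  sum≤length : ∀ {f : A → ℚ} {l} → All (λ e → f e ≤ 1ℚ) l → sumℚ (map f l) ≤ ℕtoℚ (length l)
  sum≤length {l = l} f≤1 =
    ≤-trans (sum-mono-≤ f≤1) (≤-reflexive (trans (sum-const 1ℚ l) (*-identityˡ _)))

  sum-filter : ∀ {P : A → Set} (P? : ∀ e → Dec (P e)) (f : A → ℚ) l →
    sumℚ (map f (filter P? l)) ≡ sumℚ (map (λ e → if does (P? e) then f e else 0ℚ) l)
  sum-filter P? f []      = refl
  sum-filter P? f (e ∷ l) with does (P? e)
  ... | true  = cong (f e +_) (sum-filter P? f l)
  ... | false = trans (sum-filter P? f l) (sym (+-identityˡ _))

∑-distrib-+₄ : ∀ {n} (f g h k : Fin n → ℚ) →
  ∑[ v < n ] (f v + g v + h v + k v) ≡ sum f + sum g + sum h + sum k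
∑-distrib-+₄ f g h k =
  trans (∑-distrib-+ (λ v → f v + g v + h v) k)
        (cong (_+ sum k) (trans (∑-distrib-+ (λ v → f v + g v) h) (cong (_+ sum h) (∑-distrib-+ f g))))

∑-mono-≤ : ∀ {n} {f g : Fin n → ℚ} → (∀ v → f v ≤ g v) → sum f ≤ sum g
∑-mono-≤ {ℕ.zero}  f≤g = ≤-refl
∑-mono-≤ {ℕ.suc n} f≤g = +-mono-≤ (f≤g zero) (∑-mono-≤ (f≤g ∘ suc))

∑-sumℚ-comm : ∀ {n} {A : Set} (f : Fin n → A → ℚ) l →
  ∑[ v < n ] sumℚ (map (f v) l) ≡ sumℚ (map (λ e → ∑[ v < n ] f v e) l)
∑-sumℚ-comm {n} f []      = sum-replicate-zero n
∑-sumℚ-comm {n} f (e ∷ l) =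
  trans (∑-distrib-+ (λ v → f v e) _) (cong (∑[ v < n ] f v e +_) (∑-sumℚ-comm f l))

∑-select : ∀ {n} (w : Fin n) (b : Fin n → Bool) (g : Fin n → ℚ) →
  ∑[ v < n ] (if does (w ≟ v) ∧ b v then g v else 0ℚ) ≡ (if b w then g w else 0ℚ)
∑-select {ℕ.suc n} zero    b g =
  trans (cong ((if b zero then g zero else 0ℚ) +_) (sum-replicate-zero n)) (+-identityʳ _)
∑-select {ℕ.suc n} (suc w) b g =
  trans (+-identityˡ (∑[ v < n ] (if does (w ≟ v) ∧ b (suc v) then g (suc v) else 0ℚ)))
        (∑-select w (b ∘ suc) (g ∘ suc))

-- Double counting: e is counted only at the vertex π e.
∑-sum-filter-≟ : ∀ {n} {A : Set} (π : A → Fin n) (Q : Fin n → A → Bool) (h : Fin n → A → ℚ) l →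
  ∑[ v < n ] sumℚ (map (h v) (filter (λ e → (π e ≟ v) ×-dec T? (Q v e)) l))
  ≡ sumℚ (map (λ e → if Q (π e) e then h (π e) e else 0ℚ) l)
∑-sum-filter-≟ {n} π Q h l = begin
  ∑[ v < n ] sumℚ (map (h v) (filter (P? v) l))
    ≡⟨ sum-cong-≗ (λ v → sum-filter (P? v) (h v) l) ⟩
  ∑[ v < n ] sumℚ (map (λ e → if does (π e ≟ v) ∧ Q v e then h v e else 0ℚ) l)
    ≡⟨ ∑-sumℚ-comm (λ v e → if does (π e ≟ v) ∧ Q v e then h v e else 0ℚ) l ⟩
  sumℚ (map (λ e → ∑[ v < n ] (if does (π e ≟ v) ∧ Q v e then h v e else 0ℚ)) l)
    ≡⟨ sum-cong (All.universal (λ e → ∑-select (π e) (λ v → Q v e) (λ v → h v e)) l) ⟩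
  sumℚ (map (λ e → if Q (π e) e then h (π e) e else 0ℚ) l)
    ∎
  where
  P? : ∀ v e → Dec ((π e ≡ v) × T (Q v e))
  P? v e = (π e ≟ v) ×-dec T? (Q v e)

-- Multi-affine functions attain their maximum over the cube at a vertex

Extensional : ∀ {n} → ((Fin n → ℚ) → ℚ) → Set
Extensional F = ∀ {x y} → x ≗ y → F x ≡ F y

MultiAffine : ∀ {n} → ((Fin n → ℚ) → ℚ) → Set
MultiAffine F = ∀ x i →
  F x ≡ (1ℚ - x i) * F (updateAt x i (const 0ℚ)) + x i * F (updateAt x i (const 1ℚ))

restrict : ∀ {n} → ((Fin (ℕ.suc n) → ℚ) → ℚ) → ℚ → (Fin n → ℚ) → ℚ
restrict F c z = F (c ∷ᶠ z)

module _ {n} {F : (Fin (ℕ.suc n) → ℚ) → ℚ} (ext : Extensional F) where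

  restrict-extensional : ∀ c → Extensional (restrict F c)
  restrict-extensional c z≗w = ext λ { zero → refl ; (suc i) → z≗w i }

  restrict-multiAffine : MultiAffine F → ∀ c → MultiAffine (restrict F c)
  restrict-multiAffine aff c z i =
    trans (aff (c ∷ᶠ z) (suc i)) (cong₂ (λ a b → (1ℚ - z i) * a + z i * b) (ext shift) (ext shift))
    where
    shift : ∀ {t} → updateAt (c ∷ᶠ z) (suc i) (const t) ≗ c ∷ᶠ updateAt z i (const t)
    shift zero    = refl
    shift (suc j) = refl

multiAffine-max-at-vertex : ∀ {n} (F : (Fin n → ℚ) → ℚ) → Extensional F → MultiAffine F →
  ∀ x → (∀ i → x i ∈[0,1]) → Any (λ β → F x ≤ F (λ i → boolToℚ (β i))) (allAssignments n)
multiAffine-max-at-vertex {ℕ.zero}  F ext aff x x∈ = here (≤-reflexive (ext λ ()))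
multiAffine-max-at-vertex {ℕ.suc n} F ext aff x x∈ = choose (≤-total (F₁ y) (F₀ y))
  where
  y : Fin n → ℚ
  y = tail x
  F₀ F₁ : (Fin n → ℚ) → ℚ
  F₀ = restrict F 0ℚ
  F₁ = restrict F 1ℚ

  Fx≤ : ∀ {K} → F₀ y ≤ K → F₁ y ≤ K → F x ≤ K
  Fx≤ F₀y≤K F₁y≤K = subst (_≤ _)
    (sym (trans (aff x zero) (cong₂ (λ a b → (1ℚ - x zero) * a + x zero * b) (ext first) (ext first))))
    (convex-≤ (proj₁ (x∈ zero)) (proj₂ (x∈ zero)) F₀y≤K F₁y≤K)
    where
    first : ∀ {t} → updateAt x zero (const t) ≗ t ∷ᶠ y
    first zero    = refl
    first (suc j) = refl

  rounded : ∀ c → Any (λ β → restrict F (boolToℚ c) y ≤ restrict F (boolToℚ c) (λ i → boolToℚ (β i)))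
                      (allAssignments n)
  rounded c = multiAffine-max-at-vertex (restrict F (boolToℚ c)) (restrict-extensional ext _)
                (restrict-multiAffine ext aff _) y (x∈ ∘ suc)

  extend : ∀ {K} c → Any (λ β → K ≤ restrict F (boolToℚ c) (λ i → boolToℚ (β i))) (allAssignments n)
         → Any (λ β → K ≤ F (λ i → boolToℚ (β i))) (allAssignments (ℕ.suc n))
  extend false = Any.++⁺ˡ ∘ Any.map⁺ ∘ Any.map λ K≤ →
    ≤-trans K≤ (≤-reflexive (ext λ { zero → refl ; (suc i) → refl }))
  extend true  = Any.++⁺ʳ _ ∘ Any.map⁺ ∘ Any.map λ K≤ →
    ≤-trans K≤ (≤-reflexive (ext λ { zero → refl ; (suc i) → refl }))

  choose : F₁ y ≤ F₀ y ⊎ F₀ y ≤ F₁ y → Any (λ β → F x ≤ F (λ i → boolToℚ (β i))) (allAssignments (ℕ.suc n))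
  choose (inj₁ F₁≤F₀) = extend false (Any.map (≤-trans (Fx≤ ≤-refl F₁≤F₀)) (rounded false))
  choose (inj₂ F₀≤F₁) = extend true  (Any.map (≤-trans (Fx≤ F₀≤F₁ ≤-refl)) (rounded true))

-- The value of an assignment and the rounding bound val ≤ maxval

weight-extensional : ∀ {n} (E : List (Fin n × Fin n)) → Extensional (weight E)
weight-extensional E x≗y =
  sum-cong (All.universal (λ e → cong₂ (λ a b → a * (1ℚ - b)) (x≗y (proj₁ e)) (x≗y (proj₂ e))) E)

edgeTerm-multiAffine : ∀ {n} (x : Fin n → ℚ) i {u w} → u ≢ w →
  let x⁰ = updateAt x i (const 0ℚ); x¹ = updateAt x i (const 1ℚ) in
  x u * (1ℚ - x w) ≡ (1ℚ - x i) * (x⁰ u * (1ℚ - x⁰ w)) + x i * (x¹ u * (1ℚ - x¹ w))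
edgeTerm-multiAffine x i {u} {w} u≢w with i ≟ u | i ≟ w
... | yes refl | yes refl = ⊥-elim (u≢w refl)
... | yes refl | no i≢w
  rewrite updateAt-updates i {const 0ℚ} x | updateAt-updates i {const 1ℚ} x
        | updateAt-minimal w i {const 0ℚ} x (i≢w ∘ sym) | updateAt-minimal w i {const 1ℚ} x (i≢w ∘ sym)
  = solve 2 (λ t b → t :* (con 1ℚ :- b)
                   := (con 1ℚ :- t) :* (con 0ℚ :* (con 1ℚ :- b)) :+ t :* (con 1ℚ :* (con 1ℚ :- b)))
            refl (x i) (x w)
... | no i≢u | yes refl
  rewrite updateAt-updates i {const 0ℚ} x | updateAt-updates i {const 1ℚ} x
        | updateAt-minimal u i {const 0ℚ} x (i≢u ∘ sym) | updateAt-minimal u i {const 1ℚ} x (i≢u ∘ sym)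
  = solve 2 (λ t a → a :* (con 1ℚ :- t)
                   := (con 1ℚ :- t) :* (a :* (con 1ℚ :- con 0ℚ)) :+ t :* (a :* (con 1ℚ :- con 1ℚ)))
            refl (x i) (x u)
... | no i≢u | no i≢w
  rewrite updateAt-minimal u i {const 0ℚ} x (i≢u ∘ sym) | updateAt-minimal u i {const 1ℚ} x (i≢u ∘ sym)
        | updateAt-minimal w i {const 0ℚ} x (i≢w ∘ sym) | updateAt-minimal w i {const 1ℚ} x (i≢w ∘ sym)
  = solve 3 (λ t a b → a :* (con 1ℚ :- b)
                     := (con 1ℚ :- t) :* (a :* (con 1ℚ :- b)) :+ t :* (a :* (con 1ℚ :- b)))
            refl (x i) (x u) (x w)

weight-multiAffine : ∀ {n} (E : List (Fin n × Fin n)) → All (λ e → proj₁ e ≢ proj₂ e) E →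
  MultiAffine (weight E)
weight-multiAffine []      []                x i =
  solve 1 (λ t → con 0ℚ := (con 1ℚ :- t) :* con 0ℚ :+ t :* con 0ℚ) refl (x i)
weight-multiAffine (e ∷ E) (u≢w ∷ loopless) x i =
  trans (cong₂ _+_ (edgeTerm-multiAffine x i u≢w) (weight-multiAffine E loopless x i))
        (solve 5 (λ t a b c d → ((con 1ℚ :- t) :* a :+ t :* b) :+ ((con 1ℚ :- t) :* c :+ t :* d)
                               := (con 1ℚ :- t) :* (a :+ c) :+ t :* (b :+ d)) refl (x i) _ _ _ _)

0≤weight : ∀ {n} (E : List (Fin n × Fin n)) {x} → (∀ v → x v ∈[0,1]) → 0ℚ ≤ weight E x
0≤weight E x∈ = 0≤sum (All.universal (λ e → 0≤* (proj₁ (x∈ (proj₁ e)))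
                                                 (proj₁ (complement∈[0,1] (x∈ (proj₂ e))))) E)

inverseLength : ∀ {A : Set} → List A → ℚ
inverseLength []      = 0ℚ
inverseLength (_ ∷ l) = ℤ.+ 1 / ℕ.suc (length l)

0≤inverseLength : ∀ {A : Set} (l : List A) → 0ℚ ≤ inverseLength l
0≤inverseLength []      = ≤-refl
0≤inverseLength (_ ∷ l) = nonNegative⁻¹ _ {{normalize-nonNeg 1 (ℕ.suc (length l))}}

≤-foldr-⊔ : ∀ {q r} {qs : List ℚ} → Any (q ≤_) qs → q ≤ foldr _⊔_ r qs
≤-foldr-⊔ {qs = p ∷ _} (here q≤p) = ≤-trans q≤p (p≤p⊔q p _)
≤-foldr-⊔ {qs = p ∷ _} (there q≤) = ≤-trans (≤-foldr-⊔ q≤) (p≤q⊔p p _)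

foldr-⊔-≤ : ∀ {r K} {qs : List ℚ} → r ≤ K → All (_≤ K) qs → foldr _⊔_ r qs ≤ K
foldr-⊔-≤ r≤K []           = r≤K
foldr-⊔-≤ r≤K (p≤K ∷ ps≤K) = ⊔-lub p≤K (foldr-⊔-≤ r≤K ps≤K)

module _ {n} (G : Graph n) where

  val≡weight*inverseLength : ∀ x → val G x ≡ weight (edges G) x * inverseLength (edges G)
  val≡weight*inverseLength x with edges G
  ... | []    = sym (*-zeroʳ 0ℚ)
  ... | _ ∷ _ = refl

  val-mono-≤ : ∀ {x y} → weight (edges G) x ≤ weight (edges G) y → val G x ≤ val G y
  val-mono-≤ {x} {y} Wx≤Wy =
    subst₂ _≤_ (sym (val≡weight*inverseLength x)) (sym (val≡weight*inverseLength y))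
      (*-monoʳ-≤-nonNeg _ {{nonNegative (0≤inverseLength (edges G))}} Wx≤Wy)

  0≤val : ∀ {x} → (∀ v → x v ∈[0,1]) → 0ℚ ≤ val G x
  0≤val {x} x∈ = subst (0ℚ ≤_) (sym (val≡weight*inverseLength x))
    (0≤* (0≤weight (edges G) x∈) (0≤inverseLength (edges G)))

  val≤maxval : ∀ {x} → (∀ v → x v ∈[0,1]) → val G x ≤ maxval G
  val≤maxval {x} x∈ = ≤-foldr-⊔ (Any.map⁺ (Any.map val-mono-≤
    (multiAffine-max-at-vertex (weight (edges G)) (weight-extensional (edges G))
      (weight-multiAffine (edges G) (noLoops G)) x x∈)))

  maxval-lub : ∀ {K} → (∀ β → val G (λ v → boolToℚ (β v)) ≤ K) → maxval G ≤ K
  maxval-lub {K} val≤K = foldr-⊔-≤ 0≤K (All.map⁺ (All.universal val≤K (allAssignments n)))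
    where
    0≤K : 0ℚ ≤ K
    0≤K = ≤-trans (0≤val (λ _ → boolToℚ∈[0,1] false)) (val≤K (const false))

-- The rounding rule posFormula

data PosCase (x yin yout : ℚ) : ℚ → Set where
  at-one   : x ≤ - yin → PosCase x yin yout 1ℚ
  at-zero  : - yin < x → yout < x → PosCase x yin yout 0ℚ
  interior : ∀ {p} → - yin < x → x ≤ yout → p * (yin + yout) ≡ yout - x → PosCase x yin yout p

posFormula-case : ∀ x yin yout → PosCase x yin yout (posFormula x yin yout)
posFormula-case x yin yout with x ℚ.≤? - yin | x ℚ.≤? yout | yin + yout ℚ.≟ 0ℚ
... | yes x≤-yin | _         | _     = at-one x≤-yin
... | no x≰-yin  | no x≰yout | _     = at-zero (≰⇒> x≰-yin) (≰⇒> x≰yout)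
... | no x≰-yin  | yes x≤yout | yes s≡0 = ⊥-elim (x≰-yin (subst (x ≤_) yout≡-yin x≤yout))
  where
  yout≡-yin : yout ≡ - yin
  yout≡-yin = begin
    yout                ≡⟨ solve 2 (λ a b → b := (a :+ b) :- a) refl yin yout ⟩
    (yin + yout) - yin  ≡⟨ cong (_- yin) s≡0 ⟩
    0ℚ - yin            ≡⟨ +-identityˡ (- yin) ⟩
    - yin               ∎
... | no x≰-yin  | yes x≤yout | no s≢0 = interior (≰⇒> x≰-yin) x≤yout (begin
  (yout - x) ÷ s * s        ≡⟨ *-assoc (yout - x) (1/ s) s ⟩
  (yout - x) * (1/ s * s)   ≡⟨ cong ((yout - x) *_) (*-inverseˡ s) ⟩
  (yout - x) * 1ℚ           ≡⟨ *-identityʳ (yout - x) ⟩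
  yout - x                  ∎)
  where
  s : ℚ
  s = yin + yout
  instance
    _ : Data.Rational.NonZero s
    _ = ≢-nonZero s≢0

p<q⇒0<q-p : ∀ {p q} → p < q → 0ℚ < q - p
p<q⇒0<q-p {p} {q} p<q = subst (_< q - p) (+-inverseʳ p) (+-monoˡ-< (- p) p<q)

posCase-∈[0,1] : ∀ {x yin yout p} → PosCase x yin yout p → p ∈[0,1]
posCase-∈[0,1] (at-one _)                   = ≤ᵇ⇒≤ tt , ≤-refl
posCase-∈[0,1] (at-zero _ _)                = ≤-refl , ≤ᵇ⇒≤ tt
posCase-∈[0,1] {x} {yin} {yout} {p} (interior -yin<x x≤yout ps≡yout-x) =
  *-cancelʳ-≤-pos s (subst₂ _≤_ (sym (*-zeroˡ s)) (sym ps≡yout-x) (p≤q⇒0≤q-p x≤yout)) ,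
  *-cancelʳ-≤-pos s (subst₂ _≤_ (sym ps≡yout-x) (sym (*-identityˡ s))
    (≤-byDifference (<⇒≤ (p<q⇒0<q-p -yin<x))
      (solve 3 (λ a b x → x :- (:- a) := (a :+ b) :- (b :- x)) refl yin yout x)))
  where
  s : ℚ
  s = yin + yout
  instance
    _ : Positive s
    _ = positive (subst (0ℚ <_) (solve 2 (λ a b → b :- (:- a) := a :+ b) refl yin yout)
                   (p<q⇒0<q-p (<-≤-trans -yin<x x≤yout)))

-- With A = yout - x and B = yin + x, p * B and (1 - p) * A bound the gain of moving a vertex
-- from p to 0 and to 1 respectively.
Balanced : (x yin yout p : ℚ) → Set
Balanced x yin yout p = p * (yin + x) ≤ m × (1ℚ - p) * (yout - x) ≤ m
  where
  m : ℚ
  m = ½ * (p * (yout - x) + (1ℚ - p) * (yin + x))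

balanced-at-one : ∀ {x yin yout} → 0ℚ ≤ yin + yout → x ≤ - yin → Balanced x yin yout 1ℚ
balanced-at-one {x} {yin} {yout} 0≤s x≤-yin =
  ≤-byDifference (0≤+ (0≤* 0≤½ 0≤s) (0≤* 0≤3/2 0≤-yin-x))
    (solve 3 (λ a b x → con ½ :* (a :+ b) :+ (con 1ℚ :+ con ½) :* ((:- a) :- x)
                      := con ½ :* (con 1ℚ :* (b :- x) :+ (con 1ℚ :- con 1ℚ) :* (a :+ x))
                         :- con 1ℚ :* (a :+ x))
           refl yin yout x) ,
  ≤-byDifference (0≤* 0≤½ (0≤+ 0≤s 0≤-yin-x))
    (solve 3 (λ a b x → con ½ :* ((a :+ b) :+ ((:- a) :- x))
                      := con ½ :* (con 1ℚ :* (b :- x) :+ (con 1ℚ :- con 1ℚ) :* (a :+ x))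
                         :- (con 1ℚ :- con 1ℚ) :* (b :- x))
           refl yin yout x)
  where
  0≤3/2 : 0ℚ ≤ 1ℚ + ½
  0≤3/2 = ≤ᵇ⇒≤ tt
  0≤-yin-x : 0ℚ ≤ - yin - x
  0≤-yin-x = p≤q⇒0≤q-p x≤-yin

balanced-at-zero : ∀ {x yin yout} → - yin < x → yout < x → Balanced x yin yout 0ℚ
balanced-at-zero {x} {yin} {yout} -yin<x yout<x =
  ≤-byDifference (0≤* 0≤½ 0≤x+yin)
    (solve 3 (λ a b x → con ½ :* (x :- (:- a))
                      := con ½ :* (con 0ℚ :* (b :- x) :+ (con 1ℚ :- con 0ℚ) :* (a :+ x))
                         :- con 0ℚ :* (a :+ x))
           refl yin yout x) ,
  ≤-byDifference (0≤+ (0≤* 0≤½ 0≤x+yin) (p≤q⇒0≤q-p (<⇒≤ yout<x)))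
    (solve 3 (λ a b x → con ½ :* (x :- (:- a)) :+ (x :- b)
                      := con ½ :* (con 0ℚ :* (b :- x) :+ (con 1ℚ :- con 0ℚ) :* (a :+ x))
                         :- (con 1ℚ :- con 0ℚ) :* (b :- x))
           refl yin yout x)
  where
  0≤x+yin : 0ℚ ≤ x - - yin
  0≤x+yin = p≤q⇒0≤q-p (<⇒≤ -yin<x)

-- p * (yin + yout) = yout - x makes both gaps equal to ½ (yin + yout) (2p - 1)².
balanced-interior : ∀ {x yin yout p} → 0ℚ ≤ yin + yout → p * (yin + yout) ≡ yout - x →
  Balanced x yin yout p
balanced-interior {x} {yin} {yout} {p} 0≤s ps≡yout-x =
  ≤-byDifference (0≤+*zero (p + p - ½) 0≤square d≡0)
    (solve 4 (λ a b x p → con ½ :* (a :+ b) :* ((p :+ p :- con 1ℚ) :* (p :+ p :- con 1ℚ))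
                           :+ (p :+ p :- con ½) :* ((b :- x) :- p :* (a :+ b))
                        := con ½ :* (p :* (b :- x) :+ (con 1ℚ :- p) :* (a :+ x)) :- p :* (a :+ x))
           refl yin yout x p) ,
  ≤-byDifference (0≤+*zero (p + p - 1ℚ - ½) 0≤square d≡0)
    (solve 4 (λ a b x p → con ½ :* (a :+ b) :* ((p :+ p :- con 1ℚ) :* (p :+ p :- con 1ℚ))
                           :+ (p :+ p :- con 1ℚ :- con ½) :* ((b :- x) :- p :* (a :+ b))
                        := con ½ :* (p :* (b :- x) :+ (con 1ℚ :- p) :* (a :+ x))
                           :- (con 1ℚ :- p) :* (b :- x))
           refl yin yout x p)
  where
  0≤square : 0ℚ ≤ ½ * (yin + yout) * ((p + p - 1ℚ) * (p + p - 1ℚ))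
  0≤square = 0≤* (0≤* 0≤½ 0≤s) (0≤p*p (p + p - 1ℚ))
  d≡0 : (yout - x) - p * (yin + yout) ≡ 0ℚ
  d≡0 = trans (cong (λ q → (yout - x) - q) ps≡yout-x) (+-inverseʳ (yout - x))

posCase-balanced : ∀ {x yin yout p} → 0ℚ ≤ yin + yout → PosCase x yin yout p → Balanced x yin yout p
posCase-balanced 0≤s (at-one x≤-yin)          = balanced-at-one 0≤s x≤-yin
posCase-balanced 0≤s (at-zero -yin<x yout<x)  = balanced-at-zero -yin<x yout<x
posCase-balanced {x} {yin} {yout} {p} 0≤s (interior _ _ ps≡yout-x) =
  balanced-interior {x} {yin} {yout} {p} 0≤s ps≡yout-x

module _ {x yin yout I O hin hout ℓin ℓout p : ℚ} (case : PosCase x yin yout p)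
         (0≤I : 0ℚ ≤ I) (I≤yin : I ≤ yin) (0≤O : 0ℚ ≤ O) (O≤yout : O ≤ yout)
         (0≤ℓin : 0ℚ ≤ ℓin) (0≤ℓout : 0ℚ ≤ ℓout)
         (yin≤hin+ℓin : yin ≤ hin + ℓin) (yout≤hout+ℓout : yout ≤ hout + ℓout) where

  private
    m : ℚ
    m = ½ * (p * (yout - x) + (1ℚ - p) * (yin + x))

    0≤p : 0ℚ ≤ p
    0≤p = proj₁ (posCase-∈[0,1] case)

    0≤1-p : 0ℚ ≤ 1ℚ - p
    0≤1-p = proj₁ (complement∈[0,1] (posCase-∈[0,1] case))

    balanced : Balanced x yin yout p
    balanced = posCase-balanced (0≤+ (≤-trans 0≤I I≤yin) (≤-trans 0≤O O≤yout)) case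

    m≤bound : m ≤ ½ * (p * (hout - x) + (1ℚ - p) * (x + hin)) + ½ * (ℓin + ℓout)
    m≤bound = ≤-byDifference
      (0≤* 0≤½ (0≤+ (0≤+ (0≤+ (0≤* 0≤p (p≤q⇒0≤q-p yout≤hout+ℓout))
                                 (0≤* 0≤1-p (p≤q⇒0≤q-p yin≤hin+ℓin)))
                           (0≤* 0≤p 0≤ℓin))
                     (0≤* 0≤1-p 0≤ℓout)))
      (solve 8 (λ x yin yout hin hout ℓin ℓout p →
          con ½ :* (p :* ((hout :+ ℓout) :- yout) :+ (con 1ℚ :- p) :* ((hin :+ ℓin) :- yin)
                    :+ p :* ℓin :+ (con 1ℚ :- p) :* ℓout)
          := (con ½ :* (p :* (hout :- x) :+ (con 1ℚ :- p) :* (x :+ hin)) :+ con ½ :* (ℓin :+ ℓout))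
             :- con ½ :* (p :* (yout :- x) :+ (con 1ℚ :- p) :* (yin :+ x)))
        refl x yin yout hin hout ℓin ℓout p)

  vertex-inequality : ∀ β →
    (boolToℚ β - p) * (O - I - x) ≤ ½ * (p * (hout - x) + (1ℚ - p) * (x + hin)) + ½ * (ℓin + ℓout)
  vertex-inequality false = ≤-trans
    (≤-byDifference (0≤* 0≤p (0≤+ (p≤q⇒0≤q-p I≤yin) 0≤O))
      (solve 5 (λ x yin I O p → p :* ((yin :- I) :+ O) := p :* (yin :+ x) :- (con 0ℚ :- p) :* (O :- I :- x))
        refl x yin I O p))
    (≤-trans (proj₁ balanced) m≤bound)
  vertex-inequality true = ≤-trans
    (≤-byDifference (0≤* 0≤1-p (0≤+ (p≤q⇒0≤q-p O≤yout) 0≤I))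
      (solve 5 (λ x yout I O p → (con 1ℚ :- p) :* ((yout :- O) :+ I)
                                := (con 1ℚ :- p) :* (yout :- x) :- (con 1ℚ :- p) :* (O :- I :- x))
        refl x yout I O p))
    (≤-trans (proj₂ balanced) m≤bound)

-- The assignment pos

module _ {n k} (G : Graph n) (χ : Fin n → Fin k) (α : ℚ) where

  below : Fin n → Fin n → Bool
  below u v = toℕ (χ u) ℕ.<ᵇ toℕ (χ v)

  step-cong : ∀ v {p q : Fin n → ℚ} → (∀ u → T (below u v) → p u ≡ q u) →
    step G χ α v p ≡ step G χ α v q
  step-cong v {p} {q} p≈q = cong₂ (λ zi zo → posFormula (zi - zo) (y-in G χ α v) (y-out G χ α v))
    (sum-cong (All.map (λ {e} (_ , u<v) → p≈q (proj₁ e) u<v) (All.all-filter _ (edges G))))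
    (sum-cong (All.map (λ {e} (_ , w<v) → cong (λ q → 1ℚ - q) (p≈q (proj₂ e) w<v)) (All.all-filter _ (edges G))))

  posUpTo-agree : ∀ c d u → toℕ (χ u) ℕ.< c → toℕ (χ u) ℕ.< d →
    posUpTo G χ α c u ≡ posUpTo G χ α d u
  posUpTo-agree (ℕ.suc c) (ℕ.suc d) u (ℕ.s≤s χu≤c) (ℕ.s≤s χu≤d) = step-cong u λ w w<u →
    let χw<χu = ℕ.<ᵇ⇒< _ _ w<u in
    posUpTo-agree c d w (ℕ.<-≤-trans χw<χu χu≤c) (ℕ.<-≤-trans χw<χu χu≤d)

  pos-step : ∀ v → pos G χ α v ≡ step G χ α v (pos G χ α)
  pos-step v = step-cong v λ u u<v → posUpTo-agree (toℕ (χ v)) _ u (ℕ.<ᵇ⇒< _ _ u<v) ℕ.≤-refl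

  pos-case : ∀ v → PosCase (z-in G χ α v (pos G χ α) - z-out G χ α v (pos G χ α))
                           (y-in G χ α v) (y-out G χ α v) (pos G χ α v)
  pos-case v = subst (PosCase _ _ _) (sym (pos-step v)) (posFormula-case _ _ _)

  pos∈[0,1] : ∀ v → pos G χ α v ∈[0,1]
  pos∈[0,1] v = posCase-∈[0,1] (pos-case v)

  module _ (proper : Proper G χ) where

    below-exclusive : ∀ {u w} → χ u ≢ χ w → below u w ≡ not (below w u)
    below-exclusive {u} {w} χu≢χw =
      exclusive (ℕ.<ᵇ-reflects-< (toℕ (χ u)) (toℕ (χ w))) (ℕ.<ᵇ-reflects-< (toℕ (χ w)) (toℕ (χ u)))
      where
      exclusive : ∀ {b b'} → Reflects (toℕ (χ u) ℕ.< toℕ (χ w)) b →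
                  Reflects (toℕ (χ w) ℕ.< toℕ (χ u)) b' → b ≡ not b'
      exclusive (ofʸ u<w) (ofʸ w<u) = ⊥-elim (ℕ.<-asym u<w w<u)
      exclusive (ofʸ _)   (ofⁿ _)   = refl
      exclusive (ofⁿ _)   (ofʸ _)   = refl
      exclusive (ofⁿ u≮w) (ofⁿ w≮u) =
        ⊥-elim (χu≢χw (Fin.toℕ-injective (ℕ.≤-antisym (ℕ.≮⇒≥ w≮u) (ℕ.≮⇒≥ u≮w))))

    incidenceSum : (inLo outLo inHi outHi : Fin n → Fin n × Fin n → ℚ) → Fin n → ℚ
    incidenceSum inLo outLo inHi outHi v =
      sumℚ (map (inLo v) (Ein-lo G χ α v)) + sumℚ (map (outLo v) (Eout-lo G χ α v))
      + sumℚ (map (inHi v) (Ein-hi G χ α v)) + sumℚ (map (outHi v) (Eout-hi G χ α v))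

    -- Properness makes every edge (u , w) lie in exactly one of Eout-hi u, Eout-lo u
    -- and, correspondingly, in Ein-lo w or Ein-hi w.
    ∑-incidenceSum : ∀ inLo outLo inHi outHi (t : Fin n × Fin n → ℚ) →
      (∀ u w → inLo w (u , w) + outHi u (u , w) ≡ t (u , w)) →
      (∀ u w → outLo u (u , w) + inHi w (u , w) ≡ t (u , w)) →
      ∑[ v < n ] incidenceSum inLo outLo inHi outHi v ≡ sumℚ (map t (edges G))
    ∑-incidenceSum inLo outLo inHi outHi t ascending descending =
      trans (∑-distrib-+₄ (at inLo (Ein-lo G χ α)) (at outLo (Eout-lo G χ α))
                          (at inHi (Ein-hi G χ α)) (at outHi (Eout-hi G χ α)))
     (trans (cong₂ _+_ (cong₂ _+_ (cong₂ _+_ (∑-sum-filter-≟ proj₂ (λ v e → below (proj₁ e) v) inLo E)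
                                             (∑-sum-filter-≟ proj₁ (λ v e → below (proj₂ e) v) outLo E))
                                  (∑-sum-filter-≟ proj₂ (λ v e → below v (proj₁ e)) inHi E))
                       (∑-sum-filter-≟ proj₁ (λ v e → below v (proj₂ e)) outHi E))
     (trans (sym (sum-+₄ (λ e → when (below (proj₁ e) (proj₂ e)) (inLo (proj₂ e) e))
                         (λ e → when (below (proj₂ e) (proj₁ e)) (outLo (proj₁ e) e))
                         (λ e → when (below (proj₂ e) (proj₁ e)) (inHi (proj₂ e) e))
                         (λ e → when (below (proj₁ e) (proj₂ e)) (outHi (proj₁ e) e)) E))
            (sum-cong (All.map (λ {e} → per-edge (proj₁ e) (proj₂ e)) proper))))
      where
      E : List (Fin n × Fin n)
      E = edges G
      at : (Fin n → Fin n × Fin n → ℚ) → (Fin n → List (Fin n × Fin n)) → Fin n → ℚ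
      at f L v = sumℚ (map (f v) (L v))
      when : Bool → ℚ → ℚ
      when c q = if c then q else 0ℚ
      per-edge : ∀ u w → χ u ≢ χ w →
        when (below u w) (inLo w (u , w)) + when (below w u) (outLo u (u , w))
        + when (below w u) (inHi w (u , w)) + when (below u w) (outHi u (u , w)) ≡ t (u , w)
      per-edge u w χu≢χw = split (below u w) (below w u) (below-exclusive χu≢χw) (ascending u w) (descending u w)
        where
        split : ∀ c c' {a b d e} → c ≡ not c' → a + e ≡ t (u , w) → b + d ≡ t (u , w) →
          when c a + when c' b + when c' d + when c e ≡ t (u , w)
        split true  false {a} {e = e} refl a+e≡t _ =
          trans (solve 2 (λ a e → a :+ con 0ℚ :+ con 0ℚ :+ e := a :+ e) refl a e) a+e≡t
        split false true {b = b} {d} refl _ b+d≡t =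
          trans (solve 2 (λ b d → con 0ℚ :+ b :+ d :+ con 0ℚ := b :+ d) refl b d) b+d≡t

    module _ (0≤α : 0ℚ ≤ α) (β : Fin n → Bool) where

      private
        p b x I O #in-lo #out-lo #in-hi #out-hi : Fin n → ℚ
        p = pos G χ α
        b v = boolToℚ (β v)
        x v = z-in G χ α v p - z-out G χ α v p
        I v = sumℚ (map (λ e → b (proj₁ e)) (Ein-hi G χ α v))
        O v = sumℚ (map (λ e → 1ℚ - b (proj₂ e)) (Eout-hi G χ α v))
        #in-lo v = ℕtoℚ (length (Ein-lo G χ α v))
        #out-lo v = ℕtoℚ (length (Eout-lo G χ α v))
        #in-hi v = ℕtoℚ (length (Ein-hi G χ α v))
        #out-hi v = ℕtoℚ (length (Eout-hi G χ α v))

      gain gainBound : Fin n → ℚ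
      gain v = (b v - p v) * (O v - I v - x v)
      gainBound v = ½ * (p v * (#out-hi v - x v) + (1ℚ - p v) * (x v + #in-hi v))
                  + ½ * (α * #in-lo v + α * #out-lo v)

      gain≤gainBound : ∀ v → gain v ≤ gainBound v
      gain≤gainBound v = vertex-inequality {hin = #in-hi v} {hout = #out-hi v} (pos-case v)
        (0≤sum (All.universal (λ e → proj₁ (b∈ (proj₁ e))) (Ein-hi G χ α v)))
        (≤-trans (sum≤length (All.universal (λ e → proj₂ (b∈ (proj₁ e))) (Ein-hi G χ α v))) (p≤p⊔q _ _))
        (0≤sum (All.universal (λ e → proj₁ (b̄∈ (proj₂ e))) (Eout-hi G χ α v)))
        (≤-trans (sum≤length (All.universal (λ e → proj₂ (b̄∈ (proj₂ e))) (Eout-hi G χ α v))) (p≤p⊔q _ _))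
        (0≤α*# (Ein-lo G χ α v)) (0≤α*# (Eout-lo G χ α v))
        (p⊔q≤p+q (0≤ℕtoℚ (length (Ein-hi G χ α v))) (0≤α*# (Ein-lo G χ α v)))
        (p⊔q≤p+q (0≤ℕtoℚ (length (Eout-hi G χ α v))) (0≤α*# (Eout-lo G χ α v)))
        (β v)
        where
        b∈ b̄∈ : ∀ u → _ ∈[0,1]
        b∈ u = boolToℚ∈[0,1] (β u)
        b̄∈ u = complement∈[0,1] (b∈ u)
        0≤α*# : ∀ (l : List (Fin n × Fin n)) → 0ℚ ≤ α * ℕtoℚ (length l)
        0≤α*# l = 0≤* 0≤α (0≤ℕtoℚ (length l))

      ∑-gain : ∑[ v < n ] gain v ≡ weight (edges G) b - weight (edges G) p
      ∑-gain = begin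
        ∑[ v < n ] gain v
          ≡⟨ sum-cong-≗ local ⟨
        ∑[ v < n ] incidenceSum inLo outLo inHi outHi v
          ≡⟨ ∑-incidenceSum inLo outLo inHi outHi t
               (λ u w → solve 4 (λ bu bw pu pw → (pw :- bw) :* pu :+ (bu :- pu) :* (con 1ℚ :- bw)
                                                := bu :* (con 1ℚ :- bw) :- pu :* (con 1ℚ :- pw))
                                refl (b u) (b w) (p u) (p w))
               (λ u w → solve 4 (λ bu bw pu pw → (bu :- pu) :* (con 1ℚ :- pw) :+ (pw :- bw) :* bu
                                                := bu :* (con 1ℚ :- bw) :- pu :* (con 1ℚ :- pw))
                                refl (b u) (b w) (p u) (p w)) ⟩
        sumℚ (map t (edges G))
          ≡⟨ sum-- _ _ (edges G) ⟩
        weight (edges G) b - weight (edges G) p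
          ∎
        where
        inLo outLo inHi outHi : Fin n → Fin n × Fin n → ℚ
        inLo  v e = (p v - b v) * p (proj₁ e)
        outLo v e = (b v - p v) * (1ℚ - p (proj₂ e))
        inHi  v e = (p v - b v) * b (proj₁ e)
        outHi v e = (b v - p v) * (1ℚ - b (proj₂ e))
        t : Fin n × Fin n → ℚ
        t e = b (proj₁ e) * (1ℚ - b (proj₂ e)) - p (proj₁ e) * (1ℚ - p (proj₂ e))
        local : ∀ v → incidenceSum inLo outLo inHi outHi v ≡ gain v
        local v =
          trans (cong₂ _+_ (cong₂ _+_ (cong₂ _+_ (sum-*ˡ (p v - b v) _ (Ein-lo G χ α v))
                                                 (sum-*ˡ (b v - p v) _ (Eout-lo G χ α v)))
                                      (sum-*ˡ (p v - b v) _ (Ein-hi G χ α v)))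
                           (sum-*ˡ (b v - p v) _ (Eout-hi G χ α v)))
                (solve 6 (λ bv pv zi zo I O → (pv :- bv) :* zi :+ (bv :- pv) :* zo :+ (pv :- bv) :* I :+ (bv :- pv) :* O
                                             := (bv :- pv) :* (O :- I :- (zi :- zo)))
                         refl (b v) (p v) (z-in G χ α v p) (z-out G χ α v p) (I v) (O v))

      ∑-gainBound : ∑[ v < n ] gainBound v ≡ weight (edges G) p + (α + α) * weight (edges G) (const ½)
      ∑-gainBound = begin
        ∑[ v < n ] gainBound v
          ≡⟨ sum-cong-≗ local ⟨
        ∑[ v < n ] incidenceSum inLo outLo inHi outHi v
          ≡⟨ ∑-incidenceSum inLo outLo inHi outHi t
               (λ u w → solve 3 (λ pu pw a → (con ½ :* (con 1ℚ :- (pw :+ pw))) :* pu :+ con ½ :* a :+ con ½ :* pu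
                                            := pu :* (con 1ℚ :- pw) :+ (a :+ a) :* (con ½ :* (con 1ℚ :- con ½)))
                                refl (p u) (p w) α)
               (λ u w → solve 3 (λ pu pw a → (con ½ :* (pu :+ pu :- con 1ℚ)) :* (con 1ℚ :- pw) :+ con ½ :* a
                                              :+ con ½ :* (con 1ℚ :- pw)
                                            := pu :* (con 1ℚ :- pw) :+ (a :+ a) :* (con ½ :* (con 1ℚ :- con ½)))
                                refl (p u) (p w) α) ⟩
        sumℚ (map t (edges G))
          ≡⟨ trans (sum-+ _ _ (edges G)) (cong (weight (edges G) p +_) (sum-*ˡ (α + α) _ (edges G))) ⟩
        weight (edges G) p + (α + α) * weight (edges G) (const ½)
          ∎
        where
        inLo outLo inHi outHi : Fin n → Fin n × Fin n → ℚ
        inLo  v e = ½ * (1ℚ - (p v + p v)) * p (proj₁ e) + ½ * α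
        outLo v e = ½ * (p v + p v - 1ℚ) * (1ℚ - p (proj₂ e)) + ½ * α
        inHi  v _ = ½ * (1ℚ - p v)
        outHi v _ = ½ * p v
        t : Fin n × Fin n → ℚ
        t e = p (proj₁ e) * (1ℚ - p (proj₂ e)) + (α + α) * (½ * (1ℚ - ½))
        local : ∀ v → incidenceSum inLo outLo inHi outHi v ≡ gainBound v
        local v =
          trans (cong₂ _+_ (cong₂ _+_ (cong₂ _+_ (sum-affine (½ * (1ℚ - (p v + p v))) (λ e → p (proj₁ e)) (½ * α) (Ein-lo G χ α v))
                                                 (sum-affine (½ * (p v + p v - 1ℚ)) (λ e → 1ℚ - p (proj₂ e)) (½ * α)
                                                             (Eout-lo G χ α v)))
                                      (sum-const (½ * (1ℚ - p v)) (Ein-hi G χ α v)))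
                           (sum-const (½ * p v) (Eout-hi G χ α v)))
                (solve 8 (λ pv zi zo a il ol ih oh →
                            con ½ :* (con 1ℚ :- (pv :+ pv)) :* zi :+ con ½ :* a :* il
                            :+ (con ½ :* (pv :+ pv :- con 1ℚ) :* zo :+ con ½ :* a :* ol)
                            :+ con ½ :* (con 1ℚ :- pv) :* ih :+ con ½ :* pv :* oh
                          := con ½ :* (pv :* (oh :- (zi :- zo)) :+ (con 1ℚ :- pv) :* ((zi :- zo) :+ ih))
                             :+ con ½ :* (a :* il :+ a :* ol))
                         refl (p v) (z-in G χ α v p) (z-out G χ α v p) α
                         (#in-lo v) (#out-lo v) (#in-hi v) (#out-hi v))

      weight-hybrid : weight (edges G) b - weight (edges G) p
                      ≤ weight (edges G) p + (α + α) * weight (edges G) (const ½)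
      weight-hybrid = subst₂ _≤_ ∑-gain ∑-gainBound (∑-mono-≤ gain≤gainBound)

      val-hybrid : val G b ≤ val G p + val G p + (α + α) * val G (const ½)
      val-hybrid = ≤-byDifference (0≤* (p≤q⇒0≤q-p weight-hybrid) (0≤inverseLength (edges G))) (begin
        (Wp + (α + α) * Wh - (Wb - Wp)) * c
          ≡⟨ solve 5 (λ wb wp wh a c → ((wp :+ a :* wh) :- (wb :- wp)) :* c
                                      := (wp :* c :+ wp :* c :+ a :* (wh :* c)) :- wb :* c)
                     refl Wb Wp Wh (α + α) c ⟩
        (Wp * c + Wp * c + (α + α) * (Wh * c)) - Wb * c
          ≡⟨ cong₂ _-_ (cong₂ _+_ (cong₂ _+_ val-p val-p) (cong ((α + α) *_) val-½)) val-b ⟨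
        (val G p + val G p + (α + α) * val G (const ½)) - val G b
          ∎)
        where
        Wb Wp Wh c : ℚ
        Wb = weight (edges G) b
        Wp = weight (edges G) p
        Wh = weight (edges G) (const ½)
        c = inverseLength (edges G)
        val-b : val G b ≡ Wb * c
        val-b = val≡weight*inverseLength G b
        val-p : val G p ≡ Wp * c
        val-p = val≡weight*inverseLength G p
        val-½ : val G (const ½) ≡ Wh * c
        val-½ = val≡weight*inverseLength G (const ½)

lemma7p2 : (k : ℕ) → .{{_ : NonZero k}} → {n : ℕ} → (G : Graph n) → NoIsolated G →
           (χ : Fin n → Fin k) → Proper G χ → (α : ℚ) → 0ℚ ≤ α →
           ((½ - α) * maxval G ≤ val G (pos G χ α)) × (val G (pos G χ α) ≤ maxval G)
lemma7p2 k G _ χ proper α 0≤α = lower , upper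
  where
  vp m : ℚ
  vp = val G (pos G χ α)
  m = maxval G

  upper : vp ≤ m
  upper = val≤maxval G (pos∈[0,1] G χ α)

  maxval≤ : m ≤ vp + vp + (α + α) * m
  maxval≤ = maxval-lub G λ β → ≤-trans (val-hybrid G χ α proper 0≤α β)
         (+-monoʳ-≤ (vp + vp) (*-monoˡ-≤-nonNeg (α + α) {{nonNegative (0≤+ 0≤α 0≤α)}}
                                 (val≤maxval G (const ½∈[0,1]))))

  lower : (½ - α) * m ≤ vp
  lower = ≤-byDifference (0≤* 0≤½ (p≤q⇒0≤q-p maxval≤))
    (solve 3 (λ v a m → con ½ :* ((v :+ v :+ (a :+ a) :* m) :- m) := v :- (con ½ :- a) :* m) refl vp α m)
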